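{- There is no computable enumeration $(\psi_x)_{x\in\omega}$ of all unary partial computable functions for which $(\omega,\cdot)$ with application $n\cdot m=\psi_n(m)$ is an extensional partial combinatory algebra.
   Context: A partial combinatory algebra (pca) is a set with a partial, left-associative, strict application that is combinatory complete; equivalently it contains $k,s$ with $ka$, $sab$ always defined, $kab=a$ and $sabc\simeq ac(bc)$ for all $a,b,c$ ($\simeq$: both undefined or both defined and equal). It is extensional if ($fa\simeq ga$ for all $a$) implies $f=g$. A computable enumeration of the unary partial computable functions is a sequence $(\psi_x)$ with $(x,y)\mapsto\psi_x(y)$ partial computable and every unary partial computable function equal to some $\psi_x$. -}

module Defs where

open import Data.Nat using (ℕ; zero; suc; _<_)
open import Data.Fin using (Fin)
open import Data.Vec using (Vec; []; _∷_; lookup)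
open import Data.Product using (Σ; ∃; _×_; _,_)
open import Relation.Binary.PropositionalEquality using (_≡_)
open import Relation.Nullary using (¬_)

-- Partial recursive functions (Kleene's μ-recursive functions),
-- with a big-step evaluation relation (partiality = no output).

data PR : ℕ → Set where
  zer  : ∀ {n} → PR n
  succ : PR 1
  proj : ∀ {n} → Fin n → PR n
  comp : ∀ {m n} → PR m → Vec (PR n) m → PR n
  prec : ∀ {n} → PR n → PR (suc (suc n)) → PR (suc n)
  mu   : ∀ {n} → PR (suc n) → PR n

mutual
  data _[_]⇓_ : ∀ {n} → PR n → Vec ℕ n → ℕ → Set where
    ⇓zer  : ∀ {n} {v : Vec ℕ n} → zer [ v ]⇓ 0
    ⇓succ : ∀ {x} → succ [ x ∷ [] ]⇓ suc x
    ⇓proj : ∀ {n} {i : Fin n} {v} → proj i [ v ]⇓ lookup v i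
    ⇓comp : ∀ {m n} {f : PR m} {gs : Vec (PR n) m} {v ys z} →
            gs [ v ]⇓* ys → f [ ys ]⇓ z → comp f gs [ v ]⇓ z
    ⇓prec0 : ∀ {n} {f : PR n} {g v z} → f [ v ]⇓ z → prec f g [ 0 ∷ v ]⇓ z
    ⇓precS : ∀ {n} {f : PR n} {g v k y z} →
             prec f g [ k ∷ v ]⇓ y → g [ k ∷ y ∷ v ]⇓ z →
             prec f g [ suc k ∷ v ]⇓ z
    ⇓mu   : ∀ {n} {f : PR (suc n)} {v k} →
            f [ k ∷ v ]⇓ 0 →
            (∀ j → j < k → ∃ λ r → f [ j ∷ v ]⇓ suc r) →
            mu f [ v ]⇓ k

  data _[_]⇓*_ : ∀ {m n} → Vec (PR n) m → Vec ℕ n → Vec ℕ m → Set where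
    ⇓[] : ∀ {n} {v : Vec ℕ n} → [] [ v ]⇓* []
    ⇓∷  : ∀ {m n} {g : PR n} {gs : Vec (PR n) m} {v y ys} →
          g [ v ]⇓ y → gs [ v ]⇓* ys → (g ∷ gs) [ v ]⇓* (y ∷ ys)

_⇔_ : Set → Set → Set
A ⇔ B = (A → B) × (B → A)

-- A sequence of unary partial functions ψ, given as a graph:
-- ψ x y z  means  ψ_x(y) is defined and equals z.

Seq : Set₁
Seq = ℕ → ℕ → ℕ → Set

ComputableEnumeration : Seq → Set
ComputableEnumeration ψ =
  (Σ (PR 2) λ e → ∀ x y z → ψ x y z ⇔ (e [ x ∷ y ∷ [] ]⇓ z))
  × (∀ (g : PR 1) → ∃ λ x → ∀ y z → (g [ y ∷ [] ]⇓ z) ⇔ ψ x y z)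

data Tm : Set where
  ⌜_⌝ : ℕ → Tm
  _·_ : Tm → Tm → Tm

infixl 7 _·_

data Ev (App : ℕ → ℕ → ℕ → Set) : Tm → ℕ → Set where
  ev-const : ∀ {n} → Ev App ⌜ n ⌝ n
  ev-app   : ∀ {t u a b z} → Ev App t a → Ev App u b → App a b z →
             Ev App (t · u) z

_↓[_] : Tm → (ℕ → ℕ → ℕ → Set) → Set
t ↓[ App ] = ∃ λ z → Ev App t z

Kleene : (ℕ → ℕ → ℕ → Set) → Tm → Tm → Set
Kleene App t u = ∀ z → Ev App t z ⇔ Ev App u z

IsPCA : (ℕ → ℕ → ℕ → Set) → Set
IsPCA App =
  (∀ a b z z′ → App a b z → App a b z′ → z ≡ z′) ×
  (Σ ℕ λ k → Σ ℕ λ s →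
     (∀ a → (⌜ k ⌝ · ⌜ a ⌝) ↓[ App ]) ×
     (∀ a b → (⌜ s ⌝ · ⌜ a ⌝ · ⌜ b ⌝) ↓[ App ]) ×
     (∀ a b → Ev App (⌜ k ⌝ · ⌜ a ⌝ · ⌜ b ⌝) a) ×
     (∀ a b c → Kleene App (⌜ s ⌝ · ⌜ a ⌝ · ⌜ b ⌝ · ⌜ c ⌝)
                           ((⌜ a ⌝ · ⌜ c ⌝) · (⌜ b ⌝ · ⌜ c ⌝))))

Extensional : (ℕ → ℕ → ℕ → Set) → Set
Extensional App =
  ∀ f g → (∀ a → Kleene App (⌜ f ⌝ · ⌜ a ⌝) (⌜ g ⌝ · ⌜ a ⌝)) → f ≡ g

module Submission where

-- In a pca on ℕ the term  t(x) = s (k x) (k x)  satisfies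
-- t(x)·y ≃ x·x  for every y, so t(x) is an index of a function that is either
-- nowhere defined (when x·x diverges) or everywhere defined.  Under
-- extensionality, t(x) therefore equals a fixed index u of the empty function
-- exactly when x·x diverges.  If the application is a computable enumeration,
-- x ↦ t(x) is computable, so "t(x) = u" is semi-decidable by an unbounded
-- search; hence the complement of the diagonal {x | x·x↓} would be the domain
-- of a partial computable function.  Cantor's diagonal argument forbids that.

open import Defs
open import Data.Product using (_×_; _,_; proj₁; proj₂; ∃)
open import Relation.Nullary using (¬_)
open import Data.Nat using (ℕ; zero; suc)
open import Data.Fin using () renaming (zero to fz; suc to fs)
open import Data.Vec using (Vec; []; _∷_)
open import Data.Empty using (⊥-elim)
open import Relation.Binary.PropositionalEquality
  using (_≡_; refl; cong; subst)

⇔-trans : ∀ {A B C : Set} → A ⇔ B → B ⇔ C → A ⇔ C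
⇔-trans (f , f⁻¹) (g , g⁻¹) = (λ a → g (f a)) , (λ c → f⁻¹ (g⁻¹ c))

Halts : PR 1 → ℕ → Set
Halts F x = ∃ λ z → F [ x ∷ [] ]⇓ z

constP : ∀ {n} → ℕ → PR n
constP zero    = zer
constP (suc m) = comp succ (constP m ∷ [])

constP-⇓ : ∀ {n} m {v : Vec ℕ n} → constP m [ v ]⇓ m
constP-⇓ zero    = ⇓zer
constP-⇓ (suc m) = ⇓comp (⇓∷ (constP-⇓ m) ⇓[]) ⇓succ

constP-unique : ∀ {n} m {v : Vec ℕ n} {y} → constP m [ v ]⇓ y → y ≡ m
constP-unique zero    ⇓zer                           = refl
constP-unique (suc m) (⇓comp (⇓∷ p ⇓[]) ⇓succ) = cong suc (constP-unique m p)

eqP : ℕ → PR 1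
eqP zero    = prec zer (constP 1)
eqP (suc m) = prec (constP 1) (comp (eqP m) (proj fz ∷ []))

eqP-total : ∀ m y → ∃ λ r → eqP m [ y ∷ [] ]⇓ r
eqP-total zero    zero    = 0 , ⇓prec0 ⇓zer
eqP-total zero    (suc y) = 1 , ⇓precS (proj₂ (eqP-total zero y)) (constP-⇓ 1)
eqP-total (suc m) zero    = 1 , ⇓prec0 (constP-⇓ 1)
eqP-total (suc m) (suc y) =
  _ , ⇓precS (proj₂ (eqP-total (suc m) y))
             (⇓comp (⇓∷ ⇓proj ⇓[]) (proj₂ (eqP-total m y)))

eqP-refl : ∀ m → eqP m [ m ∷ [] ]⇓ 0
eqP-refl zero    = ⇓prec0 ⇓zer
eqP-refl (suc m) =
  ⇓precS (proj₂ (eqP-total (suc m) m)) (⇓comp (⇓∷ ⇓proj ⇓[]) (eqP-refl m))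

eqP-sound : ∀ m y → eqP m [ y ∷ [] ]⇓ 0 → y ≡ m
eqP-sound zero    zero    _ = refl
eqP-sound zero    (suc y) (⇓precS _ p) with constP-unique 1 p
... | ()
eqP-sound (suc m) zero    (⇓prec0 p) with constP-unique 1 p
... | ()
eqP-sound (suc m) (suc y) (⇓precS _ (⇓comp (⇓∷ ⇓proj ⇓[]) q)) =
  cong suc (eqP-sound m y q)

nowhere : PR 1
nowhere = mu (comp succ (zer ∷ []))

nowhere-diverges : ∀ {v z} → ¬ (nowhere [ v ]⇓ z)
nowhere-diverges (⇓mu (⇓comp (⇓∷ ⇓zer ⇓[]) ()) _)

-- Unbounded search semi-decides "F x = c": searchFor F c halts on x exactly
-- when F x is defined and equal to c.  No totality of F is needed.
searchFor : PR 1 → ℕ → PR 1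
searchFor F c = mu (comp (eqP c) (comp F (proj (fs fz) ∷ []) ∷ []))

searchFor-halts⇔ : ∀ F c x → Halts (searchFor F c) x ⇔ (F [ x ∷ [] ]⇓ c)
searchFor-halts⇔ F c x = found , search
  where
  found : Halts (searchFor F c) x → F [ x ∷ [] ]⇓ c
  found (_ , ⇓mu (⇓comp (⇓∷ (⇓comp (⇓∷ ⇓proj ⇓[]) pF) ⇓[]) pEq) _) =
    subst (λ y → F [ x ∷ [] ]⇓ y) (eqP-sound c _ pEq) pF
  search : F [ x ∷ [] ]⇓ c → Halts (searchFor F c) x
  search pF = 0 , ⇓mu (⇓comp (⇓∷ (⇓comp (⇓∷ ⇓proj ⇓[]) pF) ⇓[]) (eqP-refl c))
                      (λ _ ())

Universal : Seq → Set
Universal ψ = ∀ (g : PR 1) → ∃ λ x → ∀ y z → (g [ y ∷ [] ]⇓ z) ⇔ ψ x y z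

diagonal-not-semidecidable :
  ∀ ψ → Universal ψ → (g : PR 1) →
  ¬ (∀ x → Halts g x ⇔ (∀ z → ¬ ψ x x z))
diagonal-not-semidecidable ψ univ g halts⇔ = undefined-at-d (proj₁ defined) (proj₂ defined)
  where
  d : ℕ
  d = proj₁ (univ g)
  g≡ψd : ∀ y z → (g [ y ∷ [] ]⇓ z) ⇔ ψ d y z
  g≡ψd = proj₂ (univ g)
  undefined-at-d : ∀ z → ¬ ψ d d z
  undefined-at-d z p =
    proj₁ (halts⇔ d) (z , proj₂ (g≡ψd d z) p) z p
  defined : ∃ λ z → ψ d d z
  defined with proj₂ (halts⇔ d) undefined-at-d
  ... | z , pg = z , proj₁ (g≡ψd d z) pg

data Term₁ : Set where
  var : Term₁
  con : ℕ → Term₁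
  _⊙_ : Term₁ → Term₁ → Term₁

infixl 7 _⊙_

instantiate : Term₁ → ℕ → Tm
instantiate var     x = ⌜ x ⌝
instantiate (con n) x = ⌜ n ⌝
instantiate (t ⊙ u) x = instantiate t x · instantiate u x

module Compile (App : ℕ → ℕ → ℕ → Set) (e : PR 2)
               (e-computes : ∀ a b z → App a b z ⇔ (e [ a ∷ b ∷ [] ]⇓ z)) where

  compile : Term₁ → PR 1
  compile var     = proj fz
  compile (con n) = constP n
  compile (t ⊙ u) = comp e (compile t ∷ compile u ∷ [])

  compile-sound : ∀ t x {z} → compile t [ x ∷ [] ]⇓ z → Ev App (instantiate t x) z
  compile-sound var     x ⇓proj = ev-const
  compile-sound (con n) x p with constP-unique n p
  ... | refl = ev-const
  compile-sound (t ⊙ u) x (⇓comp (⇓∷ pt (⇓∷ pu ⇓[])) pe) =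
    ev-app (compile-sound t x pt) (compile-sound u x pu) (proj₂ (e-computes _ _ _) pe)

  compile-complete : ∀ t x {z} → Ev App (instantiate t x) z → compile t [ x ∷ [] ]⇓ z
  compile-complete var     x ev-const = ⇓proj
  compile-complete (con n) x ev-const = constP-⇓ n
  compile-complete (t ⊙ u) x (ev-app pt pu r) =
    ⇓comp (⇓∷ (compile-complete t x pt) (⇓∷ (compile-complete u x pu) ⇓[]))
          (proj₁ (e-computes _ _ _) r)

ev-const-app : ∀ {App a b z} → Ev App (⌜ a ⌝ · ⌜ b ⌝) z ⇔ App a b z
ev-const-app = (λ { (ev-app ev-const ev-const p) → p }) , ev-app ev-const ev-const

module Combinators {App : ℕ → ℕ → ℕ → Set} (pca : IsPCA App) where

  functional : ∀ a b z z′ → App a b z → App a b z′ → z ≡ z′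
  functional = proj₁ pca

  k s : ℕ
  k = proj₁ (proj₂ pca)
  s = proj₁ (proj₂ (proj₂ pca))

  k-total : ∀ a → (⌜ k ⌝ · ⌜ a ⌝) ↓[ App ]
  k-total = proj₁ (proj₂ (proj₂ (proj₂ pca)))

  s-total : ∀ a b → (⌜ s ⌝ · ⌜ a ⌝ · ⌜ b ⌝) ↓[ App ]
  s-total = proj₁ (proj₂ (proj₂ (proj₂ (proj₂ pca))))

  k-law : ∀ a b → Ev App (⌜ k ⌝ · ⌜ a ⌝ · ⌜ b ⌝) a
  k-law = proj₁ (proj₂ (proj₂ (proj₂ (proj₂ (proj₂ pca)))))

  s-law : ∀ a b c → Kleene App (⌜ s ⌝ · ⌜ a ⌝ · ⌜ b ⌝ · ⌜ c ⌝)
                               ((⌜ a ⌝ · ⌜ c ⌝) · (⌜ b ⌝ · ⌜ c ⌝))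
  s-law = proj₂ (proj₂ (proj₂ (proj₂ (proj₂ (proj₂ pca)))))

  ev-unique : ∀ {t z z′} → Ev App t z → Ev App t z′ → z ≡ z′
  ev-unique ev-const ev-const = refl
  ev-unique (ev-app p q r) (ev-app p′ q′ r′) with ev-unique p p′ | ev-unique q q′
  ... | refl | refl = functional _ _ _ _ r r′

  K : ℕ → ℕ
  K x = proj₁ (k-total x)

  K-app : ∀ x y → App (K x) y x
  K-app x y with k-law x y
  ... | ev-app (ev-app ev-const ev-const p) ev-const q =
    subst (λ w → App w y x) (functional _ _ _ _ p (proj₁ ev-const-app (proj₂ (k-total x)))) q

  K-app-unique : ∀ {x y w} → Ev App (⌜ K x ⌝ · ⌜ y ⌝) w → w ≡ x
  K-app-unique {x} {y} p = ev-unique p (proj₂ ev-const-app (K-app x y))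

  tTerm : Term₁
  tTerm = con s ⊙ (con k ⊙ var) ⊙ (con k ⊙ var)

  t : ℕ → ℕ
  t x = proj₁ (s-total (K x) (K x))

  t-eval : ∀ x → Ev App (instantiate tTerm x) (t x)
  t-eval x with proj₂ (s-total (K x) (K x))
  ... | ev-app (ev-app ev-const ev-const p) ev-const q =
    ev-app (ev-app ev-const (proj₂ (k-total x)) p) (proj₂ (k-total x)) q

  t-app⇔ : ∀ x y z → App (t x) y z ⇔ App x x z
  t-app⇔ x y z = to , from
    where
    st : Ev App (⌜ s ⌝ · ⌜ K x ⌝ · ⌜ K x ⌝) (t x)
    st = proj₂ (s-total (K x) (K x))
    Kxy : Ev App (⌜ K x ⌝ · ⌜ y ⌝) x
    Kxy = proj₂ ev-const-app (K-app x y)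
    to : App (t x) y z → App x x z
    to p with proj₁ (s-law (K x) (K x) y z) (ev-app st ev-const p)
    ... | ev-app A B r with K-app-unique A | K-app-unique B
    ... | refl | refl = r
    from : App x x z → App (t x) y z
    from p with proj₂ (s-law (K x) (K x) y z) (ev-app Kxy Kxy p)
    ... | ev-app A ev-const r with ev-unique A st
    ... | refl = r

  t≡empty⇔diverges : Extensional App → ∀ u → (∀ y z → ¬ App u y z) →
                     ∀ x → (t x ≡ u) ⇔ (∀ z → ¬ App x x z)
  t≡empty⇔diverges ext u u-empty x = to , from
    where
    to : t x ≡ u → ∀ z → ¬ App x x z
    to eq z p = u-empty 0 z (subst (λ w → App w 0 z) eq (proj₂ (t-app⇔ x 0 z) p))
    from : (∀ z → ¬ App x x z) → t x ≡ u
    from diverges = ext (t x) u λ y z →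
      (λ p → ⊥-elim (diverges z (proj₁ (t-app⇔ x y z) (proj₁ ev-const-app p)))) ,
      (λ p → ⊥-elim (u-empty y z (proj₁ ev-const-app p)))

corollary6p4 : (ψ : Seq) → ComputableEnumeration ψ →
    ¬ (IsPCA ψ × Extensional ψ)
corollary6p4 ψ ((e , e-computes) , univ) (pca , ext) =
  diagonal-not-semidecidable ψ univ (searchFor (compile tTerm) u) halts⇔diverges
  where
  open Combinators pca
  open Compile ψ e e-computes

  u : ℕ
  u = proj₁ (univ nowhere)

  u-empty : ∀ y z → ¬ ψ u y z
  u-empty y z p = nowhere-diverges (proj₂ (proj₂ (univ nowhere) y z) p)

  compiled-t⇔ : ∀ x y → (compile tTerm [ x ∷ [] ]⇓ y) ⇔ (t x ≡ y)
  compiled-t⇔ x y =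
    (λ p → ev-unique (t-eval x) (compile-sound tTerm x p)) ,
    (λ { refl → compile-complete tTerm x (t-eval x) })

  halts⇔diverges : ∀ x → Halts (searchFor (compile tTerm) u) x ⇔ (∀ z → ¬ ψ x x z)
  halts⇔diverges x =
    ⇔-trans (searchFor-halts⇔ (compile tTerm) u x)
      (⇔-trans (compiled-t⇔ x u) (t≡empty⇔diverges ext u u-empty x))
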